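{- Let $m,n$ be positive integers and let $\mathcal{R}=(r_1,\ldots,r_m)$, $\mathcal{C}=(c_1,\ldots,c_n)$ be sequences of integers with $n=r_1\ge r_2\ge\cdots\ge r_m$ and $m=c_1\ge c_2\ge\cdots\ge c_n$, and assume that $(\mathcal{R},\mathcal{C})$ is consistent. Let $\alpha=\alpha(\mathcal{R},\mathcal{C})$. Then \[ \alpha\le\frac{(m-1)(n-1)}{4}. \]
   Context: The pair $(\mathcal{R},\mathcal{C})$ is consistent if there exists $F\subseteq\{1,\ldots,m\}\times\{1,\ldots,n\}$ such that for each $i$ exactly $r_i$ points of $F$ have first coordinate $i$ and for each $j$ exactly $c_j$ points of $F$ have second coordinate $j$. Let $b_i=\#\{j:c_j\ge i\}$ for $i=1,\ldots,m$ and $\alpha(\mathcal{R},\mathcal{C})=\frac12\sum_{i=1}^m|r_i-b_i|$. -}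

module Defs where

open import Data.Nat using (ℕ; zero; suc; _+_; _*_)
open import Data.Integer using (ℤ; +_; _-_; ∣_∣; _≥_; _≤_)
open import Data.Fin using (Fin; toℕ)
import Data.Fin as Fin
import Data.Nat
open import Data.Bool using (Bool; true; false)
open import Relation.Nullary.Decidable using (⌊_⌋)
open import Data.Product using (Σ; _×_)
open import Relation.Binary.PropositionalEquality using (_≡_)
import Data.Integer.Properties as ℤP

sumFin : (k : ℕ) → (Fin k → ℕ) → ℕ
sumFin zero    f = 0
sumFin (suc k) f = f Fin.zero + sumFin k (λ i → f (Fin.suc i))

bool01 : Bool → ℕ
bool01 true  = 1
bool01 false = 0

countFin : (k : ℕ) → (Fin k → Bool) → ℕ
countFin k P = sumFin k (λ i → bool01 (P i))

idx : {k : ℕ} → Fin k → ℤ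
idx i = + suc (toℕ i)

Nonincreasing : {k : ℕ} → (Fin k → ℤ) → Set
Nonincreasing {k} s = ∀ (i j : Fin k) → toℕ i Data.Nat.≤ toℕ j → s j ≤ s i

-- (R, C) consistent: there is F ⊆ [m] × [n] (as an indicator) with
-- row counts r_i and column counts c_j.
Consistent : (m n : ℕ) → (Fin m → ℤ) → (Fin n → ℤ) → Set
Consistent m n r c =
  Σ (Fin m → Fin n → Bool) λ F →
    (∀ i → r i ≡ + countFin n (λ j → F i j)) ×
    (∀ j → c j ≡ + countFin m (λ i → F i j))

b : (m n : ℕ) → (Fin n → ℤ) → Fin m → ℕ
b m n c i = countFin n (λ j → ⌊ idx i ℤP.≤? c j ⌋)

twoAlpha : (m n : ℕ) → (Fin m → ℤ) → (Fin n → ℤ) → ℕ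
twoAlpha m n r c = sumFin m (λ i → ∣ r i - + b m n c i ∣)

-- Let F have row sums R and column sums C, let A be the Ferrers diagram with row lengths R and
-- B the one with column lengths C, so that row i of B has b_i cells. In each row, |r_i - b_i| is
-- at most the number of cells of A ∖ B and B ∖ A in that row, and A and B both have |F| cells,
-- so the two differences have the same size D and 2α ≤ 2D. Since R and C are nonincreasing,
-- no row and no column meets both differences, and the first row and column, being full, meet
-- neither. If B ∖ A spans p rows and q columns and A ∖ B spans p' rows and q' columns, then
-- p + p' ≤ m - 1, q + q' ≤ n - 1, D ≤ pq and D ≤ p'q', hence 4D ≤ (m - 1)(n - 1) by AM-GM.
module Submission where

open import Defs
open import Data.Nat using (ℕ; suc; _*_; _≤_; zero; _+_; _<_; _≥_; _<ᵇ_; z≤n; s≤s)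
open import Data.Nat.Properties
open import Data.Nat.Tactic.RingSolver using (solve-∀; solve)
open import Data.Integer using (ℤ; +_; _⊖_; ∣_∣)
import Data.Integer as ℤ
import Data.Integer.Properties as ℤ
open import Data.Fin using (Fin; zero; suc; toℕ)
import Data.Fin as Fin
open import Data.Fin.Properties using (toℕ<n)
open import Data.Bool using (Bool; true; false; T; _∧_; _∨_; not)
open import Data.Bool.Properties using (T-∨)
open import Data.Empty using (⊥; ⊥-elim)
open import Data.List using (_∷_; [])
open import Data.Product using (∃; _×_; _,_; proj₂)
open import Data.Sum using (inj₁; inj₂)
open import Data.Vec.Functional using (Vector; foldr)
open import Function using (_∘_; flip; Equivalence)
open import Relation.Binary.Core using (_Preserves_⟶_)
open import Relation.Nullary using (¬_; contradiction)
open import Relation.Nullary.Decidable using (⌊_⌋; isYes≗does)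
open import Relation.Binary.PropositionalEquality
  using (_≡_; refl; sym; trans; cong; cong₂; subst; subst₂; module ≡-Reasoning)
open import Algebra.Properties.Semiring.Sum +-*-semiring
  using (sum; ∑-distrib-+; ∑-comm; *-distribˡ-sum; *-distribʳ-sum; sum-cong-≗; sum-replicate-zero)

sumFin≡sum : ∀ k (f : Fin k → ℕ) → sumFin k f ≡ sum f
sumFin≡sum zero    f = refl
sumFin≡sum (suc k) f = cong (_+_ (f zero)) (sumFin≡sum k (f ∘ suc))

sum-mono-≤ : ∀ {n} {f g : Vector ℕ n} → (∀ i → f i ≤ g i) → sum f ≤ sum g
sum-mono-≤ {zero}  f≤g = z≤n
sum-mono-≤ {suc n} f≤g = +-mono-≤ (f≤g zero) (sum-mono-≤ (f≤g ∘ suc))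

sum≤n : ∀ {n} {f : Vector ℕ n} → (∀ i → f i ≤ 1) → sum f ≤ n
sum≤n {zero}  f≤1 = z≤n
sum≤n {suc n} f≤1 = +-mono-≤ (f≤1 zero) (sum≤n (f≤1 ∘ suc))

sum*sum : ∀ {m n} (f : Vector ℕ m) (g : Vector ℕ n) →
          sum f * sum g ≡ sum (λ i → sum (λ j → f i * g j))
sum*sum f g = trans (*-distribʳ-sum (sum g) f) (sum-cong-≗ (λ i → *-distribˡ-sum (f i) g))

bool01≤1 : ∀ b → bool01 b ≤ 1
bool01≤1 true  = ≤-refl
bool01≤1 false = z≤n

T⇒bool01≡1 : ∀ {b} → T b → bool01 b ≡ 1
T⇒bool01≡1 {true} _ = refl

¬T⇒bool01≡0 : ∀ {b} → ¬ T b → bool01 b ≡ 0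
¬T⇒bool01≡0 {true}  ¬b = contradiction _ ¬b
¬T⇒bool01≡0 {false} ¬b = refl

bool01≤bool01*bool01 : ∀ {a b c} → (T a → T b) → (T a → T c) → bool01 a ≤ bool01 b * bool01 c
bool01≤bool01*bool01 {false}                 _   _   = z≤n
bool01≤bool01*bool01 {true}  {true}  {true}  _   _   = ≤-refl
bool01≤bool01*bool01 {true}  {false}         a⇒b _   = ⊥-elim (a⇒b _)
bool01≤bool01*bool01 {true}  {true}  {false} _   a⇒c = ⊥-elim (a⇒c _)

bool01+bool01≤1 : ∀ {a b} → (T a → T b → ⊥) → bool01 a + bool01 b ≤ 1
bool01+bool01≤1 {true}  {true}  disjoint = ⊥-elim (disjoint _ _)
bool01+bool01≤1 {true}  {false} _        = ≤-refl
bool01+bool01≤1 {false} {b}     _        = bool01≤1 b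

count : ∀ {n} → Vector Bool n → ℕ
count u = sum (bool01 ∘ u)

count≤n : ∀ {n} (u : Vector Bool n) → count u ≤ n
count≤n u = sum≤n (bool01≤1 ∘ u)

T⇒1≤count : ∀ {n} (u : Vector Bool n) {i} → T (u i) → 1 ≤ count u
T⇒1≤count u {zero}  uᵢ = ≤-trans (≤-reflexive (sym (T⇒bool01≡1 uᵢ))) (m≤m+n _ _)
T⇒1≤count u {suc i} uᵢ = ≤-trans (T⇒1≤count (u ∘ suc) uᵢ) (m≤n+m _ _)

count≡n⇒T : ∀ {n} (u : Vector Bool n) → count u ≡ n → ∀ i → T (u i)
count≡n⇒T {suc n} u full i with u zero in u₀
... | false = contradiction full (<⇒≢ (s≤s (count≤n (u ∘ suc))))
count≡n⇒T {suc n} u full zero    | true = subst T (sym u₀) _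
count≡n⇒T {suc n} u full (suc i) | true = count≡n⇒T (u ∘ suc) (suc-injective full) i

count-<ᵇ : ∀ {n k} → k ≤ n → count (λ (j : Fin n) → toℕ j <ᵇ k) ≡ k
count-<ᵇ {n}     {zero}  _         = sum-replicate-zero n
count-<ᵇ {suc n} {suc k} (s≤s k≤n) = cong suc (count-<ᵇ k≤n)

count+count≤n : ∀ {n} (u v : Vector Bool (suc n)) → ¬ T (u zero) → ¬ T (v zero) →
                (∀ i → T (u i) → T (v i) → ⊥) → count u + count v ≤ n
count+count≤n {n} u v ¬u₀ ¬v₀ disjoint = begin
  count u + count v
    ≡⟨ sym (∑-distrib-+ (bool01 ∘ u) (bool01 ∘ v)) ⟩
  sum (λ i → bool01 (u i) + bool01 (v i))
    ≤⟨ +-mono-≤ (≤-reflexive nothing-at-0) at-most-1-elsewhere ⟩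
  0 + n
    ∎
  where
  open ≤-Reasoning
  nothing-at-0 : bool01 (u zero) + bool01 (v zero) ≡ 0
  nothing-at-0 = cong₂ _+_ (¬T⇒bool01≡0 ¬u₀) (¬T⇒bool01≡0 ¬v₀)
  at-most-1-elsewhere : sum (λ i → bool01 (u (suc i)) + bool01 (v (suc i))) ≤ n
  at-most-1-elsewhere = sum≤n (λ i → bool01+bool01≤1 (disjoint (suc i)))

_∖_ : ∀ {n} → Vector Bool n → Vector Bool n → Vector Bool n
(u ∖ v) i = u i ∧ not (v i)

T-∖ : ∀ {a b} → T (a ∧ not b) → T a × ¬ T b
T-∖ {true} {false} _ = _ , λ ()

count-∖-balance : ∀ {n} (u v : Vector Bool n) → count u + count (v ∖ u) ≡ count v + count (u ∖ v)
count-∖-balance u v = begin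
  count u + count (v ∖ u)                         ≡⟨ sym (∑-distrib-+ (bool01 ∘ u) _) ⟩
  sum (λ i → bool01 (u i) + bool01 ((v ∖ u) i))   ≡⟨ sum-cong-≗ (λ i → pointwise (u i) (v i)) ⟩
  sum (λ i → bool01 (v i) + bool01 ((u ∖ v) i))   ≡⟨ ∑-distrib-+ (bool01 ∘ v) _ ⟩
  count v + count (u ∖ v)                         ∎
  where
  open ≡-Reasoning
  pointwise : ∀ a b → bool01 a + bool01 (b ∧ not a) ≡ bool01 b + bool01 (a ∧ not b)
  pointwise false false = refl
  pointwise false true  = refl
  pointwise true  false = refl
  pointwise true  true  = refl

m+o≡n+p⇒∣m-n∣≤p+o : ∀ {m n o p} → m + o ≡ n + p → ∣ + m ℤ.- + n ∣ ≤ p + o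
m+o≡n+p⇒∣m-n∣≤p+o {m} {n} {o} {p} eq =
  subst (λ x → ∣ x ∣ ≤ p + o) (sym m-n≡p-o) (ℤ.∣i-j∣≤∣i∣+∣j∣ (+ p) (+ o))
  where
  open ≡-Reasoning
  m-n≡p-o : + m ℤ.- + n ≡ + p ℤ.- + o
  m-n≡p-o = begin
    + m ℤ.- + n        ≡⟨ ℤ.m-n≡m⊖n m n ⟩
    m ⊖ n              ≡⟨ sym (ℤ.+-cancelˡ-⊖ o m n) ⟩
    (o + m) ⊖ (o + n)  ≡⟨ cong₂ _⊖_ (trans (+-comm o m) eq) (+-comm o n) ⟩
    (n + p) ⊖ (n + o)  ≡⟨ ℤ.+-cancelˡ-⊖ n p o ⟩
    p ⊖ o              ≡⟨ sym (ℤ.m-n≡m⊖n p o) ⟩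
    + p ℤ.- + o        ∎

∣count-count∣≤count∖ : ∀ {n} (u v : Vector Bool n) →
                        ∣ + count u ℤ.- + count v ∣ ≤ count (u ∖ v) + count (v ∖ u)
∣count-count∣≤count∖ u v =
  m+o≡n+p⇒∣m-n∣≤p+o {count u} {count v} {count (v ∖ u)} {count (u ∖ v)} (count-∖-balance u v)

total : ∀ {m n} → (Fin m → Fin n → Bool) → ℕ
total A = sum (count ∘ A)

total-flip : ∀ {m n} (A : Fin m → Fin n → Bool) → total (flip A) ≡ total A
total-flip A = sym (∑-comm (λ i j → bool01 (A i j)))

total-∖-balance : ∀ {m n} (A B : Fin m → Fin n → Bool) → total A ≡ total B →
                  total (λ i → B i ∖ A i) ≡ total (λ i → A i ∖ B i)
total-∖-balance A B ΣA≡ΣB = +-cancelˡ-≡ (total A) _ _ (begin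
  total A + total (λ i → B i ∖ A i)
    ≡⟨ sym (∑-distrib-+ (count ∘ A) _) ⟩
  sum (λ i → count (A i) + count (B i ∖ A i))
    ≡⟨ sum-cong-≗ (λ i → count-∖-balance (A i) (B i)) ⟩
  sum (λ i → count (B i) + count (A i ∖ B i))
    ≡⟨ ∑-distrib-+ (count ∘ B) _ ⟩
  total B + total (λ i → A i ∖ B i)
    ≡⟨ cong (_+ total (λ i → A i ∖ B i)) (sym ΣA≡ΣB) ⟩
  total A + total (λ i → A i ∖ B i)
    ∎)
  where open ≡-Reasoning

full-row⇒nonempty-columns : ∀ {m n} (A : Fin m → Fin n → Bool) i → count (A i) ≡ n →
                            ∀ j → 0 < count (flip A j)
full-row⇒nonempty-columns A i full j = T⇒1≤count (flip A j) (count≡n⇒T (A i) full j)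

any : ∀ {n} → Vector Bool n → Bool
any = foldr _∨_ false

T-any⁺ : ∀ {n} (u : Vector Bool n) i → T (u i) → T (any u)
T-any⁺ u zero    uᵢ = Equivalence.from T-∨ (inj₁ uᵢ)
T-any⁺ u (suc i) uᵢ = Equivalence.from (T-∨ {u zero}) (inj₂ (T-any⁺ (u ∘ suc) i uᵢ))

T-any⁻ : ∀ {n} (u : Vector Bool n) → T (any u) → ∃ λ i → T (u i)
T-any⁻ {suc n} u some with Equivalence.to (T-∨ {u zero}) some
... | inj₁ u₀   = zero , u₀
... | inj₂ rest = let i , uᵢ = T-any⁻ (u ∘ suc) rest in suc i , uᵢ

total≤rows*columns : ∀ {m n} (A : Fin m → Fin n → Bool) →
                     total A ≤ count (any ∘ A) * count (any ∘ flip A)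
total≤rows*columns A = begin
  total A
    ≤⟨ sum-mono-≤ (λ i → sum-mono-≤ (cell i)) ⟩
  sum (λ i → sum (λ j → bool01 (any (A i)) * bool01 (any (flip A j))))
    ≡⟨ sym (sum*sum (bool01 ∘ any ∘ A) (bool01 ∘ any ∘ flip A)) ⟩
  count (any ∘ A) * count (any ∘ flip A)
    ∎
  where
  open ≤-Reasoning
  cell : ∀ i j → bool01 (A i j) ≤ bool01 (any (A i)) * bool01 (any (flip A j))
  cell i j = bool01≤bool01*bool01 (T-any⁺ (A i) j) (T-any⁺ (flip A j) i)

m≤n⇒4*m*n≤[m+n]² : ∀ {m n} → m ≤ n → 4 * (m * n) ≤ (m + n) * (m + n)
m≤n⇒4*m*n≤[m+n]² {m} m≤n with m≤n⇒∃[o]m+o≡n m≤n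
... | k , refl = ≤-trans (m≤m+n _ (k * k)) (≤-reflexive (sym (square m k)))
  where
  square : ∀ m k → (m + (m + k)) * (m + (m + k)) ≡ 4 * (m * (m + k)) + k * k
  square = solve-∀

4*m*n≤[m+n]² : ∀ m n → 4 * (m * n) ≤ (m + n) * (m + n)
4*m*n≤[m+n]² m n with ≤-total m n
... | inj₁ m≤n = m≤n⇒4*m*n≤[m+n]² m≤n
... | inj₂ n≤m = subst₂ _≤_ (cong (4 *_) (*-comm n m)) (cong₂ _*_ (+-comm n m) (+-comm n m))
                   (m≤n⇒4*m*n≤[m+n]² n≤m)

square-≤⇒≤ : ∀ {m n} → m * m ≤ n * n → m ≤ n
square-≤⇒≤ m²≤n² = ≮⇒≥ (λ n<m → <⇒≱ (*-mono-< n<m n<m) m²≤n²)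

4*a≤m*n : ∀ {a p q p′ q′ m n} → a ≤ p * q → a ≤ p′ * q′ → p + p′ ≤ m → q + q′ ≤ n →
          4 * a ≤ m * n
4*a≤m*n {a} {p} {q} {p′} {q′} {m} {n} a≤pq a≤p′q′ p+p′≤m q+q′≤n = square-≤⇒≤ (begin
  (4 * a) * (4 * a)                ≡⟨ solve (a ∷ []) ⟩
  16 * (a * a)                     ≤⟨ *-monoʳ-≤ 16 (*-mono-≤ a≤pq a≤p′q′) ⟩
  16 * ((p * q) * (p′ * q′))       ≡⟨ solve (p ∷ q ∷ p′ ∷ q′ ∷ []) ⟩
  (4 * (p * p′)) * (4 * (q * q′))  ≤⟨ *-mono-≤ (am-gm p p′ p+p′≤m) (am-gm q q′ q+q′≤n) ⟩
  (m * m) * (n * n)                ≡⟨ solve (m ∷ n ∷ []) ⟩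
  (m * n) * (m * n)                ∎)
  where
  open ≤-Reasoning
  am-gm : ∀ x y {z} → x + y ≤ z → 4 * (x * y) ≤ z * z
  am-gm x y x+y≤z = ≤-trans (4*m*n≤[m+n]² x y) (*-mono-≤ x+y≤z x+y≤z)

-- diagram R is the Ferrers diagram with row lengths R; flip (diagram C) is the one with
-- column lengths C, and its row counts are the b_i of the paper.
diagram : ∀ {m n} → (Fin m → ℕ) → Fin m → Fin n → Bool
diagram R i j = toℕ j <ᵇ R i

total-diagram : ∀ {m n} (R : Fin m → ℕ) → (∀ i → R i ≤ n) → total {n = n} (diagram R) ≡ sum R
total-diagram R R≤n = sum-cong-≗ (λ i → count-<ᵇ (R≤n i))

-- The cells of flip (diagram C) outside diagram R; the transpose of gap C R is the opposite
-- difference, so statements about rows of gaps also cover columns by swapping R and C.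
gap : ∀ {m n} → (Fin m → ℕ) → (Fin n → ℕ) → Fin m → Fin n → Bool
gap R C i = flip (diagram C) i ∖ diagram R i

T-gap : ∀ {m n} (R : Fin m → ℕ) (C : Fin n → ℕ) {i j} →
        T (gap R C i j) → toℕ i < C j × R i ≤ toℕ j
T-gap R C g with T-∖ g
... | i<C , ¬j<R = <ᵇ⇒< _ _ i<C , ≮⇒≥ (¬j<R ∘ <⇒<ᵇ)

gaps-balanced : ∀ {m n} (R : Fin m → ℕ) (C : Fin n → ℕ) → (∀ i → R i ≤ n) → (∀ j → C j ≤ m) →
                sum R ≡ sum C → total (gap R C) ≡ total (gap C R)
gaps-balanced {m} {n} R C R≤n C≤m ΣR≡ΣC = trans
  (total-∖-balance (diagram {n = n} R) (flip (diagram {n = m} C)) (begin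
    total {n = n} (diagram R)  ≡⟨ total-diagram R R≤n ⟩
    sum R                      ≡⟨ ΣR≡ΣC ⟩
    sum C                      ≡⟨ sym (total-diagram C C≤m) ⟩
    total {n = m} (diagram C)  ≡⟨ sym (total-flip (diagram {n = m} C)) ⟩
    total (flip (diagram {n = m} C))  ∎))
  (total-flip (gap C R))
  where open ≡-Reasoning

discrepancy : ∀ {m n} → (Fin m → ℕ) → (Fin n → ℕ) → ℕ
discrepancy R C = sum (λ i → ∣ + R i ℤ.- + count (flip (diagram C) i) ∣)

discrepancy≤gaps : ∀ {m n} (R : Fin m → ℕ) (C : Fin n → ℕ) → (∀ i → R i ≤ n) →
                   discrepancy R C ≤ total (gap C R) + total (gap R C)
discrepancy≤gaps R C R≤n = begin
  discrepancy R C
    ≤⟨ sum-mono-≤ row ⟩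
  sum (λ i → count (flip (gap C R) i) + count (gap R C i))
    ≡⟨ ∑-distrib-+ (count ∘ flip (gap C R)) _ ⟩
  total (flip (gap C R)) + total (gap R C)
    ≡⟨ cong (_+ total (gap R C)) (total-flip (gap C R)) ⟩
  total (gap C R) + total (gap R C)
    ∎
  where
  open ≤-Reasoning
  row : ∀ i → ∣ + R i ℤ.- + count (flip (diagram C) i) ∣ ≤
              count (flip (gap C R) i) + count (gap R C i)
  row i = subst (λ x → ∣ + x ℤ.- + count (flip (diagram C) i) ∣ ≤
                         count (flip (gap C R) i) + count (gap R C i))
                (count-<ᵇ (R≤n i)) (∣count-count∣≤count∖ (diagram R i) (flip (diagram C) i))

rows-meeting-gaps : ∀ {m n} (R : Fin (suc m) → ℕ) (C : Fin (suc n) → ℕ) →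
                    C Preserves Fin._≤_ ⟶ _≥_ → suc n ≤ R zero → (∀ j → 0 < C j) →
                    count (any ∘ gap R C) + count (any ∘ flip (gap C R)) ≤ m
rows-meeting-gaps R C C↓ n<R₀ C>0 = count+count≤n _ _ no-gap₀ no-gap′₀ disjoint
  where
  no-gap₀ : ¬ T (any (gap R C zero))
  no-gap₀ g with T-any⁻ (gap R C zero) g
  ... | j , gⱼ = <⇒≱ (<-≤-trans (toℕ<n j) n<R₀) (proj₂ (T-gap R C gⱼ))

  no-gap′₀ : ¬ T (any (flip (gap C R) zero))
  no-gap′₀ g with T-any⁻ (flip (gap C R) zero) g
  ... | j , gⱼ = <⇒≱ (C>0 j) (proj₂ (T-gap C R gⱼ))

  disjoint : ∀ i → T (any (gap R C i)) → T (any (flip (gap C R) i)) → ⊥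
  disjoint i g g′ with T-any⁻ (gap R C i) g | T-any⁻ (flip (gap C R) i) g′
  ... | j , gⱼ | j′ , g′ⱼ′ with T-gap R C gⱼ | T-gap C R g′ⱼ′
  ... | i<Cⱼ , Rᵢ≤j | j′<Rᵢ , Cⱼ′≤i =
    <⇒≱ i<Cⱼ (≤-trans (C↓ (<⇒≤ (<-≤-trans j′<Rᵢ Rᵢ≤j))) Cⱼ′≤i)

gap-bound : ∀ {m n} (R : Fin (suc m) → ℕ) (C : Fin (suc n) → ℕ) →
            R Preserves Fin._≤_ ⟶ _≥_ → C Preserves Fin._≤_ ⟶ _≥_ →
            suc n ≤ R zero → suc m ≤ C zero → (∀ i → 0 < R i) → (∀ j → 0 < C j) →
            total (gap R C) ≡ total (gap C R) → 4 * total (gap R C) ≤ m * n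
gap-bound {m} {n} R C R↓ C↓ n<R₀ m<C₀ R>0 C>0 balanced =
  4*a≤m*n {p = P} {Q} {P′} {Q′} (total≤rows*columns (gap R C)) D≤P′Q′ P+P′≤m Q+Q′≤n
  where
  P Q P′ Q′ : ℕ
  P  = count (any ∘ gap R C)
  Q  = count (any ∘ flip (gap R C))
  P′ = count (any ∘ flip (gap C R))
  Q′ = count (any ∘ gap C R)
  D≤P′Q′ : total (gap R C) ≤ P′ * Q′
  D≤P′Q′ = subst₂ _≤_ (sym balanced) (*-comm Q′ P′) (total≤rows*columns (gap C R))
  P+P′≤m : P + P′ ≤ m
  P+P′≤m = rows-meeting-gaps R C C↓ n<R₀ C>0
  Q+Q′≤n : Q + Q′ ≤ n
  Q+Q′≤n = subst (_≤ n) (+-comm Q′ Q) (rows-meeting-gaps C R R↓ m<C₀ R>0)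

discrepancy-bound : ∀ {m n} (R : Fin (suc m) → ℕ) (C : Fin (suc n) → ℕ) →
                    R Preserves Fin._≤_ ⟶ _≥_ → C Preserves Fin._≤_ ⟶ _≥_ →
                    R zero ≡ suc n → C zero ≡ suc m → (∀ i → 0 < R i) → (∀ j → 0 < C j) →
                    sum R ≡ sum C → 2 * discrepancy R C ≤ m * n
discrepancy-bound {m} {n} R C R↓ C↓ R₀ C₀ R>0 C>0 ΣR≡ΣC = begin
  2 * discrepancy R C
    ≤⟨ *-monoʳ-≤ 2 (discrepancy≤gaps R C R≤n) ⟩
  2 * (total (gap C R) + total (gap R C))
    ≡⟨ cong (λ e → 2 * (e + total (gap R C))) (sym balanced) ⟩
  2 * (total (gap R C) + total (gap R C))
    ≡⟨ 2*[a+a]≡4*a (total (gap R C)) ⟩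
  4 * total (gap R C)
    ≤⟨ gap-bound R C R↓ C↓ (≤-reflexive (sym R₀)) (≤-reflexive (sym C₀)) R>0 C>0 balanced ⟩
  m * n
    ∎
  where
  open ≤-Reasoning
  R≤n : ∀ i → R i ≤ suc n
  R≤n i = ≤-trans (R↓ {zero} {i} z≤n) (≤-reflexive R₀)
  C≤m : ∀ j → C j ≤ suc m
  C≤m j = ≤-trans (C↓ {zero} {j} z≤n) (≤-reflexive C₀)
  balanced : total (gap R C) ≡ total (gap C R)
  balanced = gaps-balanced R C R≤n C≤m ΣR≡ΣC
  2*[a+a]≡4*a : ∀ a → 2 * (a + a) ≡ 4 * a
  2*[a+a]≡4*a = solve-∀

nonincreasing⇒antitone : ∀ {k} {s : Fin k → ℤ} {S : Fin k → ℕ} → (∀ i → s i ≡ + S i) →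
                         Nonincreasing s → S Preserves Fin._≤_ ⟶ _≥_
nonincreasing⇒antitone {s = s} s≡S s↓ {i} {j} i≤j =
  ℤ.drop‿+≤+ (subst₂ ℤ._≤_ (s≡S j) (s≡S i) (s↓ i j i≤j))

twoAlpha≡discrepancy : ∀ {m n} (r : Fin m → ℤ) (c : Fin n → ℤ) {R : Fin m → ℕ} {C : Fin n → ℕ} →
                       (∀ i → r i ≡ + R i) → (∀ j → c j ≡ + C j) →
                       twoAlpha m n r c ≡ discrepancy R C
twoAlpha≡discrepancy {m} {n} r c {R} {C} r≡R c≡C =
  trans (sumFin≡sum m (λ i → ∣ r i ℤ.- + b m n c i ∣))
        (sum-cong-≗ (λ i → cong₂ (λ x y → ∣ x ℤ.- + y ∣) (r≡R i) (bᵢ i)))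
  where
  bᵢ : ∀ i → b m n c i ≡ count (flip (diagram {n = m} C) i)
  bᵢ i = trans (sumFin≡sum n (λ j → bool01 ⌊ idx i ℤ.≤? c j ⌋))
    (sum-cong-≗ (λ j → cong bool01 (trans (cong (λ t → ⌊ idx i ℤ.≤? t ⌋) (c≡C j)) (isYes≗does _))))

proposition1 : (m n : ℕ) (r : Fin (suc m) → ℤ) (c : Fin (suc n) → ℤ) →
    r zero ≡ + suc n → Nonincreasing r →
    c zero ≡ + suc m → Nonincreasing c →
    Consistent (suc m) (suc n) r c →
    2 * twoAlpha (suc m) (suc n) r c ≤ m * n
proposition1 m n r c r₀ r↓ c₀ c↓ (F , rowF , colF) = begin
  2 * twoAlpha (suc m) (suc n) r c  ≡⟨ cong (2 *_) (twoAlpha≡discrepancy r c r≡R c≡C) ⟩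
  2 * discrepancy R C               ≤⟨ discrepancy-bound R C R↓ C↓ R₀ C₀ R>0 C>0 (sym (total-flip F)) ⟩
  m * n                             ∎
  where
  open ≤-Reasoning
  R : Fin (suc m) → ℕ
  R = count ∘ F
  C : Fin (suc n) → ℕ
  C = count ∘ flip F
  r≡R : ∀ i → r i ≡ + R i
  r≡R i = trans (rowF i) (cong +_ (sumFin≡sum (suc n) (bool01 ∘ F i)))
  c≡C : ∀ j → c j ≡ + C j
  c≡C j = trans (colF j) (cong +_ (sumFin≡sum (suc m) (bool01 ∘ flip F j)))
  R↓ : R Preserves Fin._≤_ ⟶ _≥_
  R↓ = nonincreasing⇒antitone r≡R r↓
  C↓ : C Preserves Fin._≤_ ⟶ _≥_
  C↓ = nonincreasing⇒antitone c≡C c↓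
  R₀ : R zero ≡ suc n
  R₀ = ℤ.+-injective (trans (sym (r≡R zero)) r₀)
  C₀ : C zero ≡ suc m
  C₀ = ℤ.+-injective (trans (sym (c≡C zero)) c₀)
  R>0 : ∀ i → 0 < R i
  R>0 = full-row⇒nonempty-columns (flip F) zero C₀
  C>0 : ∀ j → 0 < C j
  C>0 = full-row⇒nonempty-columns F zero R₀
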